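{- Let $S$ be a string, $f$ an involution on its alphabet, and $j\ge 2$. Let $\Delta$ be a positive integer and let $p_i$ and $p_{i+1}$ be two consecutive elements of $P_{j-1,\Delta}$. Then $p_i-1\in P_j$ if and only if $p_{i+1}-1\in P_j$.
   Context: An involution $f$ satisfies $f\circ f=\mathrm{id}$ and is extended letterwise to strings; a string $x$ is a generalized palindrome if $x=f(x^R)$, where $x^R$ is the reverse of $x$. For a position $j$ of $S$ (strings indexed from 1, $S[a..b]=S[a]\cdots S[b]$), $P_j$ is the increasingly sorted list of all starting positions $a\in[1..j]$ such that $S[a..j]$ is a generalized palindrome. For $\Delta\ge1$, $P_{j,\Delta}$ is the sublist of $P_j$ consisting of the elements whose predecessor in $P_j$ is smaller by exactly $\Delta$ (the first element of $P_j$, which has no predecessor, is assigned $\Delta=\infty$). -}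

module Defs where

open import Data.Nat using (ℕ; _+_; _∸_; _≤_; _<_; suc)
open import Data.List using (List; map; reverse; take; drop)
open import Data.Product using (_×_; Σ)
open import Relation.Binary.PropositionalEquality using (_≡_)
open import Relation.Nullary using (¬_)

Involution : {A : Set} → (A → A) → Set
Involution {A} f = (a : A) → f (f a) ≡ a

GenPal : {A : Set} → (A → A) → List A → Set
GenPal f x = x ≡ map f (reverse x)

-- S[a..b] for 1-indexed positions: the b - a + 1 letters starting at position a
sub : {A : Set} → List A → ℕ → ℕ → List A
sub S a b = take (suc b ∸ a) (drop (a ∸ 1) S)

InP : {A : Set} → (A → A) → List A → ℕ → ℕ → Set
InP f S j a = (1 ≤ a) × (a ≤ j) × GenPal f (sub S a j)

PredInP : {A : Set} → (A → A) → List A → ℕ → ℕ → ℕ → Set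
PredInP f S j b a =
  InP f S j b × InP f S j a × b < a ×
  ((c : ℕ) → b < c → c < a → ¬ InP f S j c)

-- a ∈ P_{j,Δ}: a ∈ P_j and its predecessor in P_j is a - Δ
-- (the first element of P_j has no predecessor, i.e. Δ = ∞, so never lies in P_{j,Δ})
InPΔ : {A : Set} → (A → A) → List A → ℕ → ℕ → ℕ → Set
InPΔ f S j Δ a = Σ ℕ (λ b → (b + Δ ≡ a) × PredInP f S j b a)

ConsecPΔ : {A : Set} → (A → A) → List A → ℕ → ℕ → ℕ → ℕ → Set
ConsecPΔ f S j Δ p q =
  InPΔ f S j Δ p × InPΔ f S j Δ q × p < q ×
  ((c : ℕ) → p < c → c < q → ¬ InPΔ f S j Δ c)

-- Two generalized palindromes ending at the same position and starting Δ apart force the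
-- period Δ on the longer one, and then every point of the progression of step Δ through
-- the predecessor of p starts a generalized palindrome as well.  As no palindrome starts
-- strictly between the predecessor q - Δ of q and q, that progression passes through
-- q - Δ; periodicity then makes the letters preceding p and q equal.  Since a palindrome
-- ending at j - 1 extends to one ending at j exactly when the letter before it is the
-- f-image of S[j], p - 1 and q - 1 belong to P_j together.
module Submission where

open import Data.Empty using (⊥-elim)
open import Data.List using (List; []; _∷_; length; map; reverse; reverseAcc; take; drop)
open import Data.List.Properties using (length-map; length-reverse; length-take; length-drop)
open import Data.Maybe using (Maybe; just; nothing) renaming (map to mapᵐ)
open import Data.Nat
open import Data.Nat.DivMod using (_/_; _%_; m≡m%n+[m/n]*n; m%n<n)
open import Data.Nat.Properties
open import Data.Nat.Tactic.RingSolver using (solve)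
open import Data.Product using (_×_; _,_; proj₁; proj₂; ∃-syntax)
open import Function.Base using (_∘_)
open import Function.Bundles using (_⇔_; mk⇔; Equivalence)
import Function.Properties.Equivalence as ⇔
open import Relation.Binary.PropositionalEquality
open import Relation.Nullary using (¬_)

open import Defs

module _ {A : Set} where

  at : List A → ℕ → Maybe A
  at []       _       = nothing
  at (x ∷ xs) zero    = just x
  at (x ∷ xs) (suc k) = at xs k

  at-map : ∀ (f : A → A) xs k → at (map f xs) k ≡ mapᵐ f (at xs k)
  at-map f []       k       = refl
  at-map f (x ∷ xs) zero    = refl
  at-map f (x ∷ xs) (suc k) = at-map f xs k

  at-take : ∀ n xs k → k < n → at (take n xs) k ≡ at xs k
  at-take (suc n) []       k       _         = refl
  at-take (suc n) (x ∷ xs) zero    _         = refl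
  at-take (suc n) (x ∷ xs) (suc k) (s≤s k<n) = at-take n xs k k<n

  at-drop : ∀ m xs k → at (drop m xs) k ≡ at xs (m + k)
  at-drop zero    xs       k = refl
  at-drop (suc m) []       k = refl
  at-drop (suc m) (x ∷ xs) k = at-drop m xs k

  at-reverseAcc-acc : ∀ acc xs k → at (reverseAcc acc xs) (k + length xs) ≡ at acc k
  at-reverseAcc-acc acc []       k = cong (at acc) (+-identityʳ k)
  at-reverseAcc-acc acc (x ∷ xs) k rewrite +-suc k (length xs) =
    at-reverseAcc-acc (x ∷ acc) xs (suc k)

  at-reverseAcc : ∀ acc xs u v → suc (u + v) ≡ length xs → at (reverseAcc acc xs) u ≡ at xs v
  at-reverseAcc acc (x ∷ xs) u zero e =
    trans (cong (at (reverseAcc (x ∷ acc) xs)) (trans (sym (+-identityʳ u)) (suc-injective e)))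
      (at-reverseAcc-acc (x ∷ acc) xs 0)
  at-reverseAcc acc (x ∷ xs) u (suc v) e =
    at-reverseAcc (x ∷ acc) xs u v (suc-injective (trans (cong suc (sym (+-suc u v))) e))

  at-reverse : ∀ xs u v → suc (u + v) ≡ length xs → at (reverse xs) u ≡ at xs v
  at-reverse = at-reverseAcc []

  at-ext : ∀ xs ys → length xs ≡ length ys → (∀ k → k < length xs → at xs k ≡ at ys k) → xs ≡ ys
  at-ext []       []       _ _ = refl
  at-ext (x ∷ xs) (y ∷ ys) e h with h 0 (s≤s z≤n)
  ... | refl = cong (x ∷_) (at-ext xs ys (suc-injective e) (λ k k<n → h (suc k) (s≤s k<n)))

module _ {A : Set} (f : A → A) where

  mapᵐ-involution : Involution f → Involution (mapᵐ f)
  mapᵐ-involution inv nothing  = refl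
  mapᵐ-involution inv (just x) = cong just (inv x)

  Mirrored : List A → Set
  Mirrored L = ∀ u v → suc (u + v) ≡ length L → at L u ≡ mapᵐ f (at L v)

  at-map-reverse : ∀ L u v → suc (u + v) ≡ length L → at (map f (reverse L)) u ≡ mapᵐ f (at L v)
  at-map-reverse L u v e = trans (at-map f (reverse L) u) (cong (mapᵐ f) (at-reverse L u v e))

  genPal⇔mirrored : ∀ L → GenPal f L ⇔ Mirrored L
  genPal⇔mirrored L = mk⇔ to from
    where
    to : GenPal f L → Mirrored L
    to pal u v e = trans (cong (λ w → at w u) pal) (at-map-reverse L u v e)

    from : Mirrored L → GenPal f L
    from mirrored = at-ext L (map f (reverse L))
      (sym (trans (length-map f (reverse L)) (length-reverse L))) pointwise
      where
      pointwise : ∀ k → k < length L → at L k ≡ at (map f (reverse L)) k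
      pointwise k k<n = trans (mirrored k v e) (sym (at-map-reverse L k v e))
        where
        v = length L ∸ suc k
        e : suc (k + v) ≡ length L
        e = m+[n∸m]≡n k<n

-- A window a J is the segment c a, …, c (J ∸ 1): its right end is exclusive.
module Window {M : Set} (c : ℕ → M) (g : M → M) where

  Palindromic : ℕ → ℕ → Set
  Palindromic a J = ∀ u v → a + suc (u + v) ≡ J → c (a + u) ≡ g (c (a + v))

  Periodic : ℕ → ℕ → ℕ → Set
  Periodic d a J = ∀ x → a ≤ x → x + d < J → c x ≡ c (x + d)

  periodic-mono : ∀ {d a b J} → a ≤ b → Periodic d a J → Periodic d b J
  periodic-mono a≤b per x b≤x = per x (≤-trans a≤b b≤x)

  palindromic-periodic : ∀ {a d J} → Palindromic a J → Palindromic (a + d) J → Periodic d a J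
  palindromic-periodic {a} {d} pal pal′ x a≤x x+d<J
    with m≤n⇒∃[o]m+o≡n a≤x | m≤n⇒∃[o]m+o≡n x+d<J
  ... | u , refl | z , refl = begin
    c (a + u)           ≡⟨ pal u (z + d) (solve (a ∷ u ∷ d ∷ z ∷ [])) ⟩
    g (c (a + (z + d))) ≡⟨ cong (g ∘ c) (solve (a ∷ z ∷ d ∷ [])) ⟩
    g (c (a + d + z))   ≡⟨ sym (pal′ u z (solve (a ∷ u ∷ d ∷ z ∷ []))) ⟩
    c (a + d + u)       ≡⟨ cong c (solve (a ∷ d ∷ u ∷ [])) ⟩
    c (a + u + d)       ∎
    where open ≡-Reasoning

  palindromic-shift : ∀ {a d J} → Palindromic a J → Periodic d a J → Palindromic (a + d) J
  palindromic-shift {a} {d} {J} pal per u v e = begin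
    c (a + d + u)       ≡⟨ cong c (solve (a ∷ d ∷ u ∷ [])) ⟩
    c (a + u + d)       ≡⟨ sym (per (a + u) (m≤m+n a u) a+u+d<J) ⟩
    c (a + u)           ≡⟨ pal u (v + d) mirror ⟩
    g (c (a + (v + d))) ≡⟨ cong (g ∘ c) (solve (a ∷ v ∷ d ∷ [])) ⟩
    g (c (a + d + v))   ∎
    where
    open ≡-Reasoning
    a+u+d<J : a + u + d < J
    a+u+d<J = ≤-trans (m≤m+n (suc (a + u + d)) v) (≤-reflexive (begin
      suc (a + u + d) + v ≡⟨ solve (a ∷ u ∷ d ∷ v ∷ []) ⟩
      a + d + suc (u + v) ≡⟨ e ⟩
      J                   ∎))
    mirror : a + suc (u + (v + d)) ≡ J
    mirror = begin
      a + suc (u + (v + d)) ≡⟨ solve (a ∷ u ∷ v ∷ d ∷ []) ⟩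
      a + d + suc (u + v)   ≡⟨ e ⟩
      J                     ∎

  palindromic-progression : ∀ {a d J} → Palindromic a J → Palindromic (a + d) J →
                            ∀ k → Palindromic (a + k * d) J
  palindromic-progression {a} {d} {J} pal pal′ zero =
    subst (λ x → Palindromic x J) (sym (+-identityʳ a)) pal
  palindromic-progression {a} {d} {J} pal pal′ (suc k) =
    subst (λ x → Palindromic x J) next
      (palindromic-shift (palindromic-progression pal pal′ k)
        (periodic-mono (m≤m+n a (k * d)) (palindromic-periodic pal pal′)))
    where
    next : a + k * d + d ≡ a + suc k * d
    next = solve (a ∷ k ∷ d ∷ [])

  periodic-iterate : ∀ {d a J} → Periodic d a J → ∀ k x → a ≤ x → x + k * d < J → c x ≡ c (x + k * d)
  periodic-iterate per zero x _ _ = cong c (sym (+-identityʳ x))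
  periodic-iterate {d} {a} {J} per (suc k) x a≤x lt = begin
    c x               ≡⟨ per x a≤x (≤-trans (s≤s (+-monoʳ-≤ x (m≤m+n d (k * d)))) lt) ⟩
    c (x + d)         ≡⟨ periodic-iterate per k (x + d) (≤-trans a≤x (m≤m+n x d))
                           (subst (_< J) (sym (+-assoc x d (k * d))) lt) ⟩
    c (x + d + k * d) ≡⟨ cong c (+-assoc x d (k * d)) ⟩
    c (x + (d + k * d)) ∎
    where open ≡-Reasoning

  palindromic-head : ∀ {x J} → Palindromic x (suc J) → x ≤ J → c x ≡ g (c J)
  palindromic-head {x} pal x≤J with m≤n⇒∃[o]m+o≡n x≤J
  ... | w , refl = trans (cong c (sym (+-identityʳ x))) (pal 0 w (+-suc x w))

  palindromic-cons : Involution g → ∀ {x J} → Palindromic (suc x) J → c x ≡ g (c J) →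
                     Palindromic x (suc J)
  palindromic-cons inv {x} {J} pal head zero v e = begin
    c (x + 0)     ≡⟨ cong c (+-identityʳ x) ⟩
    c x           ≡⟨ head ⟩
    g (c J)       ≡⟨ cong (g ∘ c) (suc-injective (trans (sym e) (+-suc x v))) ⟩
    g (c (x + v)) ∎
    where open ≡-Reasoning
  palindromic-cons inv {x} {J} pal head (suc u) zero e = begin
    c (x + suc u) ≡⟨ cong c end ⟩
    c J           ≡⟨ sym (inv (c J)) ⟩
    g (g (c J))   ≡⟨ cong g (sym head) ⟩
    g (c x)       ≡⟨ cong (g ∘ c) (sym (+-identityʳ x)) ⟩
    g (c (x + 0)) ∎
    where
    open ≡-Reasoning
    end : x + suc u ≡ J
    end = suc-injective (begin
      suc (x + suc u)      ≡⟨ solve (x ∷ u ∷ []) ⟩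
      x + suc (suc u + 0)  ≡⟨ e ⟩
      suc J                ∎)
  palindromic-cons inv {x} {J} pal head (suc u) (suc v) e = begin
    c (x + suc u)       ≡⟨ cong c (+-suc x u) ⟩
    c (suc x + u)       ≡⟨ pal u v inner ⟩
    g (c (suc x + v))   ≡⟨ cong (g ∘ c) (sym (+-suc x v)) ⟩
    g (c (x + suc v))   ∎
    where
    open ≡-Reasoning
    inner : suc x + suc (u + v) ≡ J
    inner = suc-injective (begin
      suc (suc x + suc (u + v)) ≡⟨ solve (x ∷ u ∷ v ∷ []) ⟩
      x + suc (suc u + suc v)   ≡⟨ e ⟩
      suc J                     ∎)

  palindromic-extend⇔ : Involution g → ∀ {x J} → x ≤ J → Palindromic (suc x) J →
                        Palindromic x (suc J) ⇔ (c x ≡ g (c J))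
  palindromic-extend⇔ inv x≤J pal = mk⇔ (λ pal′ → palindromic-head pal′ x≤J) (palindromic-cons inv pal)

gap⇒onProgression : ∀ (X : ℕ → Set) a d .{{_ : NonZero d}} q → a ≤ q → (∀ k → X (a + k * d)) →
                    (∀ m → q < m → m < q + d → ¬ X m) → ∃[ k ] q ≡ a + k * d
gap⇒onProgression X a d q a≤q progression gap
  with q ∸ a | m+[n∸m]≡n a≤q
... | n | refl with n % d | n / d | m≡m%n+[m/n]*n n d | m%n<n n d
...   | zero  | k | refl | _   = k , refl
...   | suc r | k | refl | r<d = ⊥-elim (gap (a + suc k * d) q<m m<q+d (progression (suc k)))
  where
  q<m : a + (suc r + k * d) < a + suc k * d
  q<m = +-monoʳ-< a (+-monoˡ-< (k * d) r<d)
  m<q+d : a + suc k * d < a + (suc r + k * d) + d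
  m<q+d = ≤-trans (m≤m+n (suc (a + suc k * d)) r) (≤-reflexive (solve (a ∷ k ∷ d ∷ r ∷ [])))

mirror-<ˡ : ∀ {u v n} → suc (u + v) ≡ n → u < n
mirror-<ˡ {u} {v} e = ≤-trans (s≤s (m≤m+n u v)) (≤-reflexive e)

mirror-<ʳ : ∀ {u v n} → suc (u + v) ≡ n → v < n
mirror-<ʳ {u} {v} e = ≤-trans (s≤s (m≤n+m v u)) (≤-reflexive e)

module _ {A : Set} (f : A → A) (S : List A) where
  open Window (at S) (mapᵐ f)

  at-window : ∀ a n u → u < n → at (take n (drop a S)) u ≡ at S (a + u)
  at-window a n u u<n = trans (at-take n (drop a S) u u<n) (at-drop a S u)

  length-window : ∀ {a J} → J ≤ length S → length (take (J ∸ a) (drop a S)) ≡ J ∸ a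
  length-window {a} {J} J≤∣S∣ = begin
    length (take (J ∸ a) (drop a S)) ≡⟨ length-take (J ∸ a) (drop a S) ⟩
    (J ∸ a) ⊓ length (drop a S)      ≡⟨ cong ((J ∸ a) ⊓_) (length-drop a S) ⟩
    (J ∸ a) ⊓ (length S ∸ a)         ≡⟨ m≤n⇒m⊓n≡m (∸-monoˡ-≤ a J≤∣S∣) ⟩
    J ∸ a                            ∎
    where open ≡-Reasoning

  mirrored-window⇔palindromic : ∀ {a J} → a ≤ J → J ≤ length S →
                                Mirrored f (take (J ∸ a) (drop a S)) ⇔ Palindromic a J
  mirrored-window⇔palindromic {a} {J} a≤J J≤∣S∣ = mk⇔ to from
    where
    open ≡-Reasoning
    w : List A
    w = take (J ∸ a) (drop a S)

    to : Mirrored f w → Palindromic a J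
    to mirrored u v e = begin
      at S (a + u)          ≡⟨ at-window a (J ∸ a) u (mirror-<ˡ e′) ⟨
      at w u                ≡⟨ mirrored u v (trans e′ (sym (length-window {a} J≤∣S∣))) ⟩
      mapᵐ f (at w v)       ≡⟨ cong (mapᵐ f) (at-window a (J ∸ a) v (mirror-<ʳ e′)) ⟩
      mapᵐ f (at S (a + v)) ∎
      where
      e′ : suc (u + v) ≡ J ∸ a
      e′ = trans (sym (m+n∸m≡n a _)) (cong (_∸ a) e)

    from : Palindromic a J → Mirrored f w
    from pal u v e = begin
      at w u                ≡⟨ at-window a (J ∸ a) u (mirror-<ˡ e′) ⟩
      at S (a + u)          ≡⟨ pal u v (trans (cong (a +_) e′) (m+[n∸m]≡n a≤J)) ⟩
      mapᵐ f (at S (a + v)) ≡⟨ cong (mapᵐ f) (at-window a (J ∸ a) v (mirror-<ʳ e′)) ⟨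
      mapᵐ f (at w v)       ∎
      where
      e′ : suc (u + v) ≡ J ∸ a
      e′ = trans e (length-window {a} J≤∣S∣)

  -- The 1-indexed S[a + 1 .. J] is the window a J of the 0-indexed at S.
  inP⇔palindromic : ∀ {a J} → J ≤ length S → InP f S J (suc a) ⇔ (a < J × Palindromic a J)
  inP⇔palindromic {a} {J} J≤∣S∣ = mk⇔
    (λ (_ , a<J , pal) → a<J , Equivalence.to (window⇔ (<⇒≤ a<J)) pal)
    (λ (a<J , pal) → s≤s z≤n , a<J , Equivalence.from (window⇔ (<⇒≤ a<J)) pal)
    where
    window⇔ : a ≤ J → GenPal f (take (J ∸ a) (drop a S)) ⇔ Palindromic a J
    window⇔ a≤J = ⇔.trans (genPal⇔mirrored f _) (mirrored-window⇔palindromic a≤J J≤∣S∣)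

  inP-extend⇔ : Involution f → ∀ {x J} → suc J ≤ length S → x < J → Palindromic (suc x) J →
                InP f S (suc J) (suc x) ⇔ (at S x ≡ mapᵐ f (at S J))
  inP-extend⇔ inv {x} J<∣S∣ x<J pal =
    ⇔.trans (inP⇔palindromic J<∣S∣)
      (⇔.trans (mk⇔ proj₂ (λ pal′ → m<n⇒m<1+n x<J , pal′))
        (palindromic-extend⇔ (mapᵐ-involution f inv) (<⇒≤ x<J) pal))

lemma5 : {A : Set} (f : A → A) → Involution f → (S : List A) →
    (j : ℕ) → 2 ≤ j → j ≤ length S →
    (Δ : ℕ) → 1 ≤ Δ → (p q : ℕ) → ConsecPΔ f S (j ∸ 1) Δ p q →
    InP f S j (p ∸ 1) ⇔ InP f S j (q ∸ 1)
lemma5 f inv S (suc J) _ J<∣S∣ Δ@(suc δ) _ _ _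
  ((suc b , refl , b∈P , p∈P , _) , (suc q₀ , refl , _ , q∈P , _ , gap) , p<q , _) =
  ⇔.trans (endpoint b p∈P)
    (⇔.trans (mk⇔ (trans (sym same-letter)) (trans same-letter)) (⇔.sym (endpoint q₀ q∈P)))
  where
  open Window (at S) (mapᵐ f)
  inP⇔ : ∀ {a} → InP f S J (suc a) ⇔ (a < J × Palindromic a J)
  inP⇔ = inP⇔palindromic f S (<⇒≤ J<∣S∣)

  palindromic : ∀ {a} → InP f S J (suc a) → Palindromic a J
  palindromic = proj₂ ∘ Equivalence.to inP⇔

  q₀+Δ<J : q₀ + Δ < J
  q₀+Δ<J = proj₁ (Equivalence.to inP⇔ q∈P)

  no-palindrome-in-gap : ∀ m → q₀ < m → m < q₀ + Δ → ¬ Palindromic m J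
  no-palindrome-in-gap m q₀<m m<q pal =
    gap (suc m) (s≤s q₀<m) (s≤s m<q) (Equivalence.from inP⇔ (<-trans m<q q₀+Δ<J , pal))

  same-letter : at S (b + δ) ≡ at S (q₀ + δ)
  same-letter with gap⇒onProgression (λ m → Palindromic m J) b Δ q₀
                     (<⇒≤ (+-cancelʳ-< Δ b q₀ (s≤s⁻¹ p<q)))
                     (palindromic-progression (palindromic b∈P) (palindromic p∈P))
                     no-palindrome-in-gap
  ... | k , q₀≡ = trans (periodic-iterate per k (b + δ) (m≤m+n b δ) lt) (cong (at S) shifted)
    where
    per : Periodic Δ b J
    per = palindromic-periodic (palindromic b∈P) (palindromic p∈P)
    shifted : b + δ + k * Δ ≡ q₀ + δ
    shifted = begin
      b + δ + k * Δ ≡⟨ solve (b ∷ δ ∷ k ∷ []) ⟩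
      b + k * Δ + δ ≡⟨ cong (_+ δ) (sym q₀≡) ⟩
      q₀ + δ        ∎
      where open ≡-Reasoning
    lt : b + δ + k * Δ < J
    lt = subst (_< J) (sym shifted) (<-trans (+-monoʳ-< q₀ (n<1+n δ)) q₀+Δ<J)

  endpoint : ∀ a → InP f S J (suc (a + Δ)) → InP f S (suc J) (a + Δ) ⇔ (at S (a + δ) ≡ mapᵐ f (at S J))
  endpoint a a+Δ∈P with Equivalence.to inP⇔ a+Δ∈P
  ... | a+Δ<J , pal rewrite +-suc a δ = inP-extend⇔ f S inv J<∣S∣ (<⇒≤ a+Δ<J) pal
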